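{- Let $G$ be a $C_4$-free graph and let $A,B$ be two disjoint cliques of $G$. Then: (1) There is a labeling $a_1,\ldots,a_{|A|}$ of the vertices of $A$ such that $N_B(a_1)\supseteq N_B(a_2)\supseteq\cdots\supseteq N_B(a_{|A|})$, and there is a labeling $b_1,\ldots,b_{|B|}$ of the vertices of $B$ such that $N_A(b_1)\supseteq N_A(b_2)\supseteq\cdots\supseteq N_A(b_{|B|})$. (2) If every vertex in $A$ has a neighbor in $B$, then some vertex of $B$ is adjacent to every vertex of $A$. (3) If every vertex in $A$ has a non-neighbor in $B$, then some vertex of $B$ has no neighbor in $A$. (4) If not every vertex of $A$ is adjacent to every vertex of $B$, then, for labelings as in (1), there are indices $i\le |A|$ and $j\le |B|$ such that $a_ib_j\notin E(G)$, $a_ib_h\in E(G)$ for all $h<j$, and $a_gb_j\in E(G)$ for all $g<i$. Moreover, every maximal clique of $G[A\cup B]$ contains one of $a_i,b_j$.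
   Context: Graphs are finite and simple. $C_4$-free means no induced cycle on 4 vertices. For a vertex $x$ and a set $S$ not containing $x$, $N_S(x)=N(x)\cap S$ is the set of neighbors of $x$ in $S$. $G[S]$ is the subgraph induced by $S$. -}

module Defs where

open import Data.Nat using (ℕ)
open import Data.Bool using (Bool; true)
open import Data.Fin using (Fin; _≤_; _<_)
open import Data.Fin.Subset using (Subset; _∈_; _∉_; _⊆_; _∪_; _∩_; ∣_∣; Nonempty; Empty)
open import Data.Product using (Σ; ∃; ∃-syntax; _×_; _,_)
open import Data.Sum using (_⊎_)
open import Relation.Nullary using (¬_)
open import Relation.Binary.PropositionalEquality using (_≡_; _≢_)
open import Function.Definitions using (Injective)

record Graph (n : ℕ) : Set where
  field
    adj   : Fin n → Fin n → Bool
    sym   : ∀ x y → adj x y ≡ adj y x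
    irrefl : ∀ x → adj x x ≡ Data.Bool.false
open Graph public

E : ∀ {n} → Graph n → Fin n → Fin n → Set
E G x y = adj G x y ≡ true

InducedC4 : ∀ {n} → Graph n → Fin n → Fin n → Fin n → Fin n → Set
InducedC4 G x y z w =
  x ≢ y × x ≢ z × x ≢ w × y ≢ z × y ≢ w × z ≢ w ×
  E G x y × E G y z × E G z w × E G w x ×
  ¬ E G x z × ¬ E G y w

C4Free : ∀ {n} → Graph n → Set
C4Free G = ∀ x y z w → ¬ InducedC4 G x y z w

Clique : ∀ {n} → Graph n → Subset n → Set
Clique G C = ∀ x y → x ∈ C → y ∈ C → x ≢ y → E G x y

MaximalCliqueIn : ∀ {n} → Graph n → Subset n → Subset n → Set
MaximalCliqueIn G S C =
  C ⊆ S × Clique G C ×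
  (∀ D → D ⊆ S → Clique G D → C ⊆ D → D ⊆ C)

Disjoint : ∀ {n} → Subset n → Subset n → Set
Disjoint A B = Empty (A ∩ B)

-- a labeling a_1, ..., a_|A| of the vertices of A (indices 0-based)
record Labeling {n : ℕ} (A : Subset n) : Set where
  field
    lab  : Fin ∣ A ∣ → Fin n
    inj  : Injective _≡_ _≡_ lab
    into : ∀ k → lab k ∈ A
    onto : ∀ v → v ∈ A → ∃[ k ] lab k ≡ v
open Labeling public

Nested : ∀ {n} (G : Graph n) {A : Subset n} → Labeling A → Subset n → Set
Nested G a B = ∀ i j → i ≤ j → ∀ v → v ∈ B → E G (lab a j) v → E G (lab a i) v

module Submission where

-- The key observation is that no two vertices x, x' of one clique can "cross"
-- the other: if x ~ b, x' ≁ b and x' ~ v, x ≁ v with b, v in the other clique,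
-- then x b v x' is an induced C4.  Hence the neighbourhoods N_B(x), x ∈ A, form
-- a chain under inclusion, and listing A by non-increasing |N_B(x)| (a sort)
-- yields the nested labeling of (1).
--
-- Given any nested labeling, (2) and (3) follow by looking at the last and the
-- first vertex of A.  For (4), i is the first index with a_i not complete to B
-- and j the first index with a_i ≁ b_j.  A maximal clique C of G[A ∪ B] is
-- closed downwards along a nested labeling of B; so if b_j ∉ C, every vertex of
-- C in B is some b_h with h < j, hence adjacent to a_i, and maximality puts a_i
-- into C.

open import Defs
open import Data.Nat using (ℕ)
open import Data.Fin using (Fin; _<_)
open import Data.Fin.Subset using (Subset; _∈_; _∪_; Nonempty)
open import Data.Product using (Σ; ∃; ∃-syntax; _×_; _,_)
open import Data.Sum using (_⊎_)
open import Relation.Nullary using (¬_)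

open import Data.Nat as ℕ using (zero; suc)
import Data.Nat.Properties as ℕP
open import Data.Bool using (true; false)
import Data.Bool.Properties as BoolP
open import Data.Fin as Fin using (zero; suc; cast; fromℕ; fromℕ<; inject; _≤_)
import Data.Fin.Properties as FinP
open import Data.Fin.Subset using (_⊆_; _⊂_; _∩_; ∣_∣; ⁅_⁆)
open import Data.Fin.Subset.Properties
  using (_∈?_; x∈p∩q⁺; x∈p∩q⁻; x∈p∪q⁻; p⊆p∪q; q⊆p∪q; x∈⁅x⁆; x∈⁅y⁆⇒x≡y; ∩-comm; p⊂q⇒∣p∣<∣q∣)
open import Data.Vec using ([]; _∷_; here; there; tabulate)
import Data.Vec.Properties as VecP
open import Data.List using (List; []; _∷_; map; length; lookup)
import Data.List.Properties as ListP
import Data.List.Membership.Propositional as List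
open import Data.List.Membership.Propositional.Properties using (∈-map⁺; ∈-map⁻; ∈-lookup)
open import Data.List.Relation.Unary.All as All using (All; []; _∷_)
open import Data.List.Relation.Unary.Any using (here; there; index)
open import Data.List.Relation.Unary.Any.Properties using (lookup-index)
open import Data.List.Relation.Unary.Unique.Propositional using (Unique; []; _∷_)
import Data.List.Relation.Unary.Unique.Propositional.Properties as UniqueP
open import Data.List.Relation.Binary.Permutation.Propositional using (_↭_; ↭-sym; ↭⇒↭ₛ)
open import Data.List.Relation.Binary.Permutation.Propositional.Properties using (∈-resp-↭; ↭-length)
open import Data.List.Relation.Binary.Permutation.Setoid.Properties using (Unique-resp-↭)
import Data.List.Sort as Sort
open import Data.List.Relation.Unary.Sorted.TotalOrder.Properties using (lookup-mono-≤)
open import Data.Product using (proj₁; proj₂)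
open import Data.Sum using (inj₁; inj₂)
open import Data.Empty using (⊥; ⊥-elim)
open import Function.Definitions using (Injective)
open import Relation.Nullary using (Dec; yes; no; contradiction)
open import Relation.Nullary.Decidable using (decidable-stable)
open import Relation.Unary using (Decidable)
open import Relation.Binary.PropositionalEquality
  using (_≡_; _≢_; ≢-sym; refl; trans; cong; subst; subst₂; setoid; module ≡-Reasoning)
import Relation.Binary.PropositionalEquality as ≡
import Relation.Binary.Construct.On as On
import Relation.Binary.Construct.Flip.EqAndOrd as Flip
open import Relation.Binary.Bundles using (DecTotalOrder)

private
  variable
    n : ℕ

elements : Subset n → List (Fin n)
elements []          = []
elements (true ∷ p)  = zero ∷ map suc (elements p)
elements (false ∷ p) = map suc (elements p)

elements-length : (p : Subset n) → length (elements p) ≡ ∣ p ∣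
elements-length []          = refl
elements-length (true ∷ p)  = cong suc (trans (ListP.length-map suc (elements p)) (elements-length p))
elements-length (false ∷ p) = trans (ListP.length-map suc (elements p)) (elements-length p)

∈-elements⁻ : (p : Subset n) {x : Fin n} → x List.∈ elements p → x ∈ p
∈-elements⁻ (true ∷ p) (here refl) = here
∈-elements⁻ (true ∷ p) (there x∈) with ∈-map⁻ suc x∈
... | _ , y∈ , refl = there (∈-elements⁻ p y∈)
∈-elements⁻ (false ∷ p) x∈ with ∈-map⁻ suc x∈
... | _ , y∈ , refl = there (∈-elements⁻ p y∈)

∈-elements⁺ : (p : Subset n) {x : Fin n} → x ∈ p → x List.∈ elements p
∈-elements⁺ (true ∷ p)  here       = here refl
∈-elements⁺ (true ∷ p)  (there x∈) = there (∈-map⁺ suc (∈-elements⁺ p x∈))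
∈-elements⁺ (false ∷ p) (there x∈) = ∈-map⁺ suc (∈-elements⁺ p x∈)

zero∉map-suc : (xs : List (Fin n)) → All (Fin.zero {n} ≢_) (map suc xs)
zero∉map-suc []       = []
zero∉map-suc (_ ∷ xs) = (λ ()) ∷ zero∉map-suc xs

elements-unique : (p : Subset n) → Unique (elements p)
elements-unique []          = []
elements-unique (true ∷ p)  =
  zero∉map-suc (elements p) ∷ UniqueP.map⁺ FinP.suc-injective (elements-unique p)
elements-unique (false ∷ p) = UniqueP.map⁺ FinP.suc-injective (elements-unique p)

lookup-injective : {X : Set} {xs : List X} → Unique xs →
  ∀ i j → lookup xs i ≡ lookup xs j → i ≡ j
lookup-injective (_ ∷ _)     zero    zero    _ = refl
lookup-injective (x∉ ∷ _)    zero    (suc j) e = ⊥-elim (All.lookup x∉ (∈-lookup j) e)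
lookup-injective (x∉ ∷ _)    (suc i) zero    e = ⊥-elim (All.lookup x∉ (∈-lookup i) (≡.sym e))
lookup-injective (_ ∷ uniq)  (suc i) (suc j) e = cong suc (lookup-injective uniq i j e)

listLabeling : (A : Subset n) (L : List (Fin n)) (len : ∣ A ∣ ≡ length L) →
  Unique L → (∀ {x} → x List.∈ L → x ∈ A) → (∀ {x} → x ∈ A → x List.∈ L) →
  Labeling A
listLabeling A L len uniq sound complete =
  record { lab = label ; inj = injective ; into = λ k → sound (∈-lookup (cast len k)) ; onto = surjective }
  where
  label : Fin ∣ A ∣ → Fin _
  label k = lookup L (cast len k)

  injective : Injective _≡_ _≡_ label
  injective {i} {j} e = begin
    i                             ≡⟨ ≡.sym (FinP.cast-involutive (≡.sym len) len i) ⟩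
    cast (≡.sym len) (cast len i) ≡⟨ cong (cast (≡.sym len)) (lookup-injective uniq _ _ e) ⟩
    cast (≡.sym len) (cast len j) ≡⟨ FinP.cast-involutive (≡.sym len) len j ⟩
    j                             ∎
    where open ≡-Reasoning

  surjective : ∀ v → v ∈ A → ∃[ k ] label k ≡ v
  surjective v v∈A = cast (≡.sym len) (index v∈L) ,
    trans (cong (lookup L) (FinP.cast-involutive len (≡.sym len) (index v∈L))) (≡.sym (lookup-index v∈L))
    where
    v∈L : v List.∈ L
    v∈L = complete v∈A

descendingLabeling : (A : Subset n) (key : Fin n → ℕ) →
  Σ (Labeling A) λ a → ∀ i j → i ≤ j → key (lab a j) ℕ.≤ key (lab a i)
descendingLabeling {n} A key =
  listLabeling A L len uniq
    (λ x∈ → ∈-elements⁻ A (∈-resp-↭ sorted-↭ x∈))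
    (λ x∈ → ∈-resp-↭ (↭-sym sorted-↭) (∈-elements⁺ A x∈)) ,
  descending
  where
  byKey : DecTotalOrder _ _ _
  byKey = On.decTotalOrder (Flip.decTotalOrder ℕP.≤-decTotalOrder) key
  open Sort byKey using (sort; sort-↭; sort-↗)

  L : List (Fin n)
  L = sort (elements A)

  sorted-↭ : L ↭ elements A
  sorted-↭ = sort-↭ (elements A)

  len : ∣ A ∣ ≡ length L
  len = ≡.sym (trans (↭-length sorted-↭) (elements-length A))

  uniq : Unique L
  uniq = Unique-resp-↭ (setoid (Fin n)) (↭⇒↭ₛ (↭-sym sorted-↭)) (elements-unique A)

  descending : ∀ i j → i ≤ j → key (lookup L (cast len j)) ℕ.≤ key (lookup L (cast len i))
  descending i j i≤j = lookup-mono-≤ (DecTotalOrder.totalOrder byKey) (sort-↗ (elements A))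
    (subst₂ ℕ._≤_ (≡.sym (FinP.toℕ-cast len i)) (≡.sym (FinP.toℕ-cast len j)) i≤j)

module _ (G : Graph n) where

  E-sym : ∀ {x y} → E G x y → E G y x
  E-sym {x} {y} e = trans (Graph.sym G y x) e

  E? : ∀ x y → Dec (E G x y)
  E? x y = adj G x y BoolP.≟ true

  N : Subset n → Fin n → Subset n
  N S x = S ∩ tabulate (adj G x)

  ∈-N⁺ : ∀ {S x y} → y ∈ S → E G x y → y ∈ N S x
  ∈-N⁺ {x = x} {y} y∈S e =
    x∈p∩q⁺ (y∈S , VecP.lookup⇒[]= y _ (trans (VecP.lookup∘tabulate (adj G x) y) e))

  ∈-N⁻ : ∀ {S x y} → y ∈ N S x → y ∈ S × E G x y
  ∈-N⁻ {S} {x} {y} y∈N with x∈p∩q⁻ S _ y∈N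
  ... | y∈S , y∈adj = y∈S , trans (≡.sym (VecP.lookup∘tabulate (adj G x) y)) (VecP.[]=⇒lookup y∈adj)

disjoint-sym : {A B : Subset n} → Disjoint A B → Disjoint B A
disjoint-sym {A = A} {B} disj (x , x∈B∩A) = disj (x , subst (x ∈_) (∩-comm B A) x∈B∩A)

disjoint-≢ : {A B : Subset n} → Disjoint A B → ∀ {x y} → x ∈ A → y ∈ B → x ≢ y
disjoint-≢ disj x∈A y∈B refl = disj (_ , x∈p∩q⁺ (x∈A , y∈B))

module _ (G : Graph n) (c4-free : C4Free G) {X Y : Subset n} (disj : Disjoint X Y)
         (X-clique : Clique G X) (Y-clique : Clique G Y) where

  no-crossing : ∀ {x x' b v} → x ∈ X → x' ∈ X → b ∈ Y → v ∈ Y →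
    E G x b → ¬ E G x' b → E G x' v → ¬ E G x v → ⊥
  no-crossing {x} {x'} {b} {v} x∈X x'∈X b∈Y v∈Y xb x'≁b x'v x≁v =
    c4-free x b v x'
      ( disjoint-≢ disj x∈X b∈Y , disjoint-≢ disj x∈X v∈Y , x≢x' , b≢v
      , ≢-sym (disjoint-≢ disj x'∈X b∈Y) , ≢-sym (disjoint-≢ disj x'∈X v∈Y)
      , xb , Y-clique b v b∈Y v∈Y b≢v , E-sym G x'v , X-clique x' x x'∈X x∈X (≢-sym x≢x')
      , x≁v , (λ bx' → x'≁b (E-sym G bx')) )
    where
    x≢x' : x ≢ x'
    x≢x' refl = x≁v x'v
    b≢v : b ≢ v
    b≢v refl = x≁v xb

  N-⊂ : ∀ {x x' v} → x ∈ X → x' ∈ X → v ∈ Y → E G x' v → ¬ E G x v → N G Y x ⊂ N G Y x'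
  N-⊂ {x} {x'} {v} x∈X x'∈X v∈Y x'v x≁v =
    N-⊆ , v , ∈-N⁺ G v∈Y x'v , λ v∈Nx → x≁v (proj₂ (∈-N⁻ G v∈Nx))
    where
    N-⊆ : N G Y x ⊆ N G Y x'
    N-⊆ b∈Nx with ∈-N⁻ G b∈Nx
    ... | b∈Y , xb = ∈-N⁺ G b∈Y (decidable-stable (E? G x' _)
                        (λ x'≁b → no-crossing x∈X x'∈X b∈Y v∈Y xb x'≁b x'v x≁v))

  nestedLabeling : Σ (Labeling X) λ a → Nested G a Y
  nestedLabeling with descendingLabeling X (λ x → ∣ N G Y x ∣)
  ... | a , descending = a , nested
    where
    nested : Nested G a Y
    nested i j i≤j v v∈Y a_j~v = decidable-stable (E? G (lab a i) v) λ a_i≁v →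
      ℕP.<⇒≱ (p⊂q⇒∣p∣<∣q∣ (N-⊂ (into a i) (into a j) v∈Y a_j~v a_i≁v)) (descending i j i≤j)

∀-labelled : {A : Subset n} (a : Labeling A) {P : Fin n → Set} →
  (∀ k → P (lab a k)) → ∀ x → x ∈ A → P x
∀-labelled a all x x∈A with onto a x x∈A
... | k , refl = all k

least : ∀ {m} → Fin m → Σ (Fin m) λ f → ∀ (k : Fin m) → f ≤ k
least {suc m} _ = zero , λ _ → ℕ.z≤n

greatest : ∀ {m} → Fin m → Σ (Fin m) λ l → ∀ (k : Fin m) → k ≤ l
greatest {suc m} _ = fromℕ m , FinP.≤fromℕ

module _ (G : Graph n) {A B : Subset n} (a : Labeling A) (nested : Nested G a B) where

  -- Part (2): a neighbour of the last vertex of A is adjacent to all of A.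
  common-neighbour : Nonempty A → (∀ x → x ∈ A → ∃[ y ] (y ∈ B × E G x y)) →
    ∃[ y ] (y ∈ B × (∀ x → x ∈ A → E G x y))
  common-neighbour (x₀ , x₀∈A) every with greatest (proj₁ (onto a x₀ x₀∈A))
  ... | l , last with every (lab a l) (into a l)
  ... | y , y∈B , a_l~y = y , y∈B , ∀-labelled a λ k → nested k l (last k) y y∈B a_l~y

  -- Part (3): a non-neighbour of the first vertex of A misses all of A.
  common-non-neighbour : Nonempty A → (∀ x → x ∈ A → ∃[ y ] (y ∈ B × ¬ E G x y)) →
    ∃[ y ] (y ∈ B × (∀ x → x ∈ A → ¬ E G x y))
  common-non-neighbour (x₀ , x₀∈A) every with least (proj₁ (onto a x₀ x₀∈A))
  ... | f , first with every (lab a f) (into a f)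
  ... | y , y∈B , a_f≁y = y , y∈B , ∀-labelled a λ k a_k~y → a_f≁y (nested f k (first k) y y∈B a_k~y)

least-failure : ∀ {m} (P : Fin m → Set) → Decidable P → ¬ (∀ i → P i) →
  ∃[ i ] (¬ P i × (∀ g → g < i → P g))
least-failure P P? ¬all with FinP.¬∀⟶∃¬-smallest _ P P? ¬all
... | i , ¬Pi , below = i , ¬Pi , λ g g<i → subst P (inject-fromℕ< g<i) (below (fromℕ< g<i))
  where
  inject-fromℕ< : ∀ {g} (g<i : g < i) → inject (fromℕ< g<i) ≡ g
  inject-fromℕ< g<i = FinP.toℕ-injective (trans (FinP.toℕ-inject _) (FinP.toℕ-fromℕ< g<i))

firstNonEdge : (G : Graph n) {A B : Subset n} (a : Labeling A) (b : Labeling B) →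
  ¬ (∀ x y → x ∈ A → y ∈ B → E G x y) →
  ∃[ i ] ∃[ j ] (¬ E G (lab a i) (lab b j)
    × (∀ h → h < j → E G (lab a i) (lab b h))
    × (∀ g → g < i → E G (lab a g) (lab b j)))
firstNonEdge G a b incomplete
  with least-failure (λ i → ∀ h → E G (lab a i) (lab b h)) (λ i → FinP.all? λ h → E? G _ _) complete
  where
  complete : ¬ (∀ i h → E G (lab a i) (lab b h))
  complete all = incomplete λ x y x∈A y∈B → ∀-labelled a {λ x → ∀ y → y ∈ _ → E G x y} (λ k → ∀-labelled b (all k)) x x∈A y y∈B
... | i , a_i-incomplete , earlier-complete
  with least-failure (λ h → E G (lab a i) (lab b h)) (λ h → E? G _ _) a_i-incomplete
... | j , a_i≁b_j , row = i , j , a_i≁b_j , row , λ g g<i → earlier-complete g g<i j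

module _ (G : Graph n) {S C : Subset n} (maximal : MaximalCliqueIn G S C) where

  private
    C⊆S : C ⊆ S
    C⊆S = proj₁ maximal

    C-clique : Clique G C
    C-clique = proj₁ (proj₂ maximal)

  -- A vertex of S adjacent to every other vertex of C lies in C: otherwise
  -- C ∪ {w} would be a larger clique of G[S].
  absorbs : ∀ {w} → w ∈ S → (∀ c → c ∈ C → c ≢ w → E G w c) → w ∈ C
  absorbs {w} w∈S adjacent =
    proj₂ (proj₂ maximal) (C ∪ ⁅ w ⁆) C∪w⊆S C∪w-clique (p⊆p∪q _) (q⊆p∪q C _ (x∈⁅x⁆ w))
    where
    C∪w⊆S : C ∪ ⁅ w ⁆ ⊆ S
    C∪w⊆S x∈ with x∈p∪q⁻ C _ x∈
    ... | inj₁ x∈C = C⊆S x∈C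
    ... | inj₂ x∈w rewrite x∈⁅y⁆⇒x≡y w x∈w = w∈S

    C∪w-clique : Clique G (C ∪ ⁅ w ⁆)
    C∪w-clique x y x∈ y∈ x≢y with x∈p∪q⁻ C _ x∈ | x∈p∪q⁻ C _ y∈
    ... | inj₁ x∈C | inj₁ y∈C = C-clique x y x∈C y∈C x≢y
    ... | inj₁ x∈C | inj₂ y∈w rewrite x∈⁅y⁆⇒x≡y w y∈w = E-sym G (adjacent x x∈C x≢y)
    ... | inj₂ x∈w | inj₁ y∈C rewrite x∈⁅y⁆⇒x≡y w x∈w = adjacent y y∈C (≢-sym x≢y)
    ... | inj₂ x∈w | inj₂ y∈w = ⊥-elim (x≢y (trans (x∈⁅y⁆⇒x≡y w x∈w) (≡.sym (x∈⁅y⁆⇒x≡y w y∈w))))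

module _ (G : Graph n) {A B : Subset n} (disj : Disjoint A B)
         (A-clique : Clique G A) (B-clique : Clique G B)
         (b : Labeling B) (nested : Nested G b A)
         {C : Subset n} (maximal : MaximalCliqueIn G (A ∪ B) C) where

  private
    C⊆A∪B : C ⊆ A ∪ B
    C⊆A∪B = proj₁ maximal

    C-clique : Clique G C
    C-clique = proj₁ (proj₂ maximal)

  -- C ∩ B is an initial segment of the nested labeling of B: a vertex of A in C
  -- sees b_h, hence every b_j with j ≤ h.
  downward-closed : ∀ {j h} → j ≤ h → lab b h ∈ C → lab b j ∈ C
  downward-closed {j} {h} j≤h b_h∈C = absorbs G maximal (q⊆p∪q A B (into b j)) adjacent
    where
    adjacent : ∀ c → c ∈ C → c ≢ lab b j → E G (lab b j) c
    adjacent c c∈C c≢b_j with x∈p∪q⁻ A B (C⊆A∪B c∈C)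
    ... | inj₂ c∈B = B-clique _ c (into b j) c∈B (≢-sym c≢b_j)
    ... | inj₁ c∈A = nested j h j≤h c c∈A
      (E-sym G (C-clique c (lab b h) c∈C b_h∈C (disjoint-≢ disj c∈A (into b h))))

  -- If x ∈ A sees every b_h with h < j, then C contains x or b_j: when b_j ∉ C,
  -- every vertex of C ∩ B comes before b_j, so x sees all of C.
  covers : ∀ {x j} → x ∈ A → (∀ h → h < j → E G x (lab b h)) → x ∈ C ⊎ lab b j ∈ C
  covers {x} {j} x∈A row with lab b j ∈? C
  ... | yes b_j∈C = inj₂ b_j∈C
  ... | no b_j∉C = inj₁ (absorbs G maximal (p⊆p∪q B x∈A) adjacent)
    where
    adjacent : ∀ c → c ∈ C → c ≢ x → E G x c
    adjacent c c∈C c≢x with x∈p∪q⁻ A B (C⊆A∪B c∈C)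
    ... | inj₁ c∈A = A-clique x c x∈A c∈A (≢-sym c≢x)
    ... | inj₂ c∈B with onto b c c∈B
    ...   | h , refl with h Fin.<? j
    ...     | yes h<j = row h h<j
    ...     | no h≮j = contradiction (downward-closed (ℕP.≮⇒≥ h≮j) c∈C) b_j∉C

lemma2p3 : ∀ (n : ℕ) (G : Graph n) → C4Free G →
    (A B : Subset n) → Disjoint A B → Clique G A → Clique G B →
    Nonempty A → Nonempty B →
    -- (1)
    ((Σ (Labeling A) λ a → Nested G a B) × (Σ (Labeling B) λ b → Nested G b A))
    -- (2)
    × ((∀ x → x ∈ A → ∃[ y ] (y ∈ B × E G x y)) → ∃[ y ] (y ∈ B × (∀ x → x ∈ A → E G x y)))
    -- (3)
    × ((∀ x → x ∈ A → ∃[ y ] (y ∈ B × ¬ E G x y)) → ∃[ y ] (y ∈ B × (∀ x → x ∈ A → ¬ E G x y)))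
    -- (4)
    × (¬ (∀ x y → x ∈ A → y ∈ B → E G x y) →
       (a : Labeling A) → Nested G a B → (b : Labeling B) → Nested G b A →
       ∃[ i ] ∃[ j ] (¬ E G (lab a i) (lab b j)
         × (∀ h → h < j → E G (lab a i) (lab b h))
         × (∀ g → g < i → E G (lab a g) (lab b j))
         × (∀ C → MaximalCliqueIn G (A ∪ B) C → lab a i ∈ C ⊎ lab b j ∈ C)))
lemma2p3 n G c4-free A B disj A-clique B-clique A-nonempty _ =
  (A-nested , B-nested) ,
  common-neighbour G (proj₁ A-nested) (proj₂ A-nested) A-nonempty ,
  common-non-neighbour G (proj₁ A-nested) (proj₂ A-nested) A-nonempty ,
  part4
  where
  A-nested : Σ (Labeling A) λ a → Nested G a B
  A-nested = nestedLabeling G c4-free disj A-clique B-clique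

  B-nested : Σ (Labeling B) λ b → Nested G b A
  B-nested = nestedLabeling G c4-free (disjoint-sym disj) B-clique A-clique

  part4 : ¬ (∀ x y → x ∈ A → y ∈ B → E G x y) →
    (a : Labeling A) → Nested G a B → (b : Labeling B) → Nested G b A →
    ∃[ i ] ∃[ j ] (¬ E G (lab a i) (lab b j)
      × (∀ h → h < j → E G (lab a i) (lab b h))
      × (∀ g → g < i → E G (lab a g) (lab b j))
      × (∀ C → MaximalCliqueIn G (A ∪ B) C → lab a i ∈ C ⊎ lab b j ∈ C))
  part4 incomplete a _ b b-nested with firstNonEdge G a b incomplete
  ... | i , j , a_i≁b_j , row , column = i , j , a_i≁b_j , row , column ,
    λ C maximal → covers G disj A-clique B-clique b b-nested maximal (into a i) row
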